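{- Let $A$ be a finite commutative unital ring such that $U(A)\neq\{\pm 1_A\}$, and suppose there exists $u\in U(A)\setminus\{\pm 1_A\}$ with $u\neq u^{ -1}$. Then the $(u,u^{ -1})$-dynomial minimal solution of $(E_A)$ is irreducible and has size $6$.
   Context: $U(A)$ is the group of units of $A$; $0_A\neq 1_A$. For $a_1,\ldots,a_n\in A$ set $M_n(a_1,\ldots,a_n)=\begin{pmatrix} a_n & -1_A\\ 1_A & 0_A\end{pmatrix}\cdots\begin{pmatrix} a_1 & -1_A\\ 1_A & 0_A\end{pmatrix}$. An $n$-tuple is a solution of $(E_A)$ if $M_n(a_1,\ldots,a_n)=\pm \mathrm{Id}$. For tuples, $(a_1,\ldots,a_n)\oplus(b_1,\ldots,b_m)=(a_1+b_m,a_2,\ldots,a_{n-1},a_n+b_1,b_2,\ldots,b_{m-1})$. Write $(a_1,\ldots,a_n)\sim(b_1,\ldots,b_n)$ if $(b_1,\ldots,b_n)$ is obtained from $(a_1,\ldots,a_n)$ or from $(a_n,\ldots,a_1)$ by a cyclic permutation. A solution $(c_1,\ldots,c_n)$ with $n\geq 3$ is reducible if there exist a solution $(b_1,\ldots,b_l)$ and a tuple $(a_1,\ldots,a_m)$ of elements of $A$ with $l,m\geq 3$ and $(c_1,\ldots,c_n)\sim(a_1,\ldots,a_m)\oplus(b_1,\ldots,b_l)$; otherwise irreducible. For $A$ finite and $a,b\in A$ with $a\neq b$, the $(a,b)$-dynomial minimal solution of $(E_A)$ is the solution of the form $(a,b,a,b,\ldots,a,b)$ (the pair $(a,b)$ repeated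 $k\geq 1$ times) of minimal size; it exists. -}

module Defs where

open import Level using (_⊔_)
open import Algebra.Bundles using (CommutativeRing)
open import Data.Nat using (ℕ; zero; suc; _≤_; _<_)
open import Data.Fin using (Fin)
open import Data.List using (List; []; _∷_; _++_; reverse; length)
open import Data.Vec as V using (Vec; toList)
open import Data.List.Relation.Binary.Pointwise using (Pointwise)
open import Data.Product using (Σ; ∃; _×_; _,_)
open import Data.Sum using (_⊎_)
open import Relation.Nullary using (¬_)

record Mat₂ {a} (A : Set a) : Set a where
  constructor mat
  field
    m11 m12 m21 m22 : A

module _ {c ℓ} (R : CommutativeRing c ℓ) where
  open CommutativeRing R renaming (Carrier to A)

  IsFinite : Set (c ⊔ ℓ)
  IsFinite = Σ ℕ λ n → Σ (Fin n → A) λ f → ∀ x → ∃ λ i → f i ≈ x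

  IsInverse : A → A → Set ℓ
  IsInverse u v = u * v ≈ 1#

  _·_ : Mat₂ A → Mat₂ A → Mat₂ A
  mat a b c' d · mat e f g h =
    mat (a * e + b * g) (a * f + b * h) (c' * e + d * g) (c' * f + d * h)

  Id₂ : Mat₂ A
  Id₂ = mat 1# 0# 0# 1#

  _≈M_ : Mat₂ A → Mat₂ A → Set ℓ
  mat a b c' d ≈M mat e f g h = (a ≈ e) × (b ≈ f) × (c' ≈ g) × (d ≈ h)

  negM : Mat₂ A → Mat₂ A
  negM (mat a b c' d) = mat (- a) (- b) (- c') (- d)

  Mₐ : A → Mat₂ A
  Mₐ a = mat a (- 1#) 1# 0#

  -- Mn (a₁ ∷ … ∷ aₙ) = M(aₙ) ⋯ M(a₁)
  Mn : List A → Mat₂ A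
  Mn []       = Id₂
  Mn (a ∷ as) = Mn as · Mₐ a

  IsSolution : List A → Set ℓ
  IsSolution as = (Mn as ≈M Id₂) ⊎ (Mn as ≈M negM Id₂)

  -- (a₁,…,aₙ) ⊕ (b₁,…,bₘ) = (a₁+bₘ, a₂,…,aₙ₋₁, aₙ+b₁, b₂,…,bₘ₋₁), for n,m ≥ 2
  _⊕_ : ∀ {n m} → Vec A (suc (suc n)) → Vec A (suc (suc m)) → List A
  _⊕_ {n} {m} as bs =
    (V.head as + V.last bs) ∷ (toList (V.init (V.tail as))
      ++ ((V.last as + V.head bs) ∷ toList (V.init (V.tail bs))))

  rotate : ℕ → List A → List A
  rotate zero    xs       = xs
  rotate (suc k) []       = []
  rotate (suc k) (x ∷ xs) = rotate k (xs ++ (x ∷ []))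

  _∼_ : List A → List A → Set (c ⊔ ℓ)
  xs ∼ ys = ∃ λ k → Pointwise _≈_ ys (rotate k xs) ⊎ Pointwise _≈_ ys (rotate k (reverse xs))

  IsReducible : List A → Set (c ⊔ ℓ)
  IsReducible cs =
    Σ ℕ λ n → Σ ℕ λ m → Σ (Vec A (suc (suc (suc n)))) λ as → Σ (Vec A (suc (suc (suc m)))) λ bs →
      IsSolution (toList bs) × (cs ∼ (as ⊕ bs))

  IsIrreducibleSolution : List A → Set (c ⊔ ℓ)
  IsIrreducibleSolution cs = IsSolution cs × (3 ≤ length cs) × ¬ IsReducible cs

  dyn : A → A → ℕ → List A
  dyn a b zero    = []
  dyn a b (suc k) = a ∷ b ∷ dyn a b k

  IsDynomialMinimal : A → A → ℕ → Set ℓ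
  IsDynomialMinimal a b k =
    (1 ≤ k) × IsSolution (dyn a b k) × (∀ j → 1 ≤ j → j < k → ¬ IsSolution (dyn a b j))

{-# OPTIONS --safe #-}
-- Right multiplication by Mₐ a acts on each row (r , s) of a 2×2 matrix as
-- (r , s) ↦ (r a + s , - r), so the upper row of Mn(a₁ … aₙ) obeys the continuant
-- recursion and the lower row of Mn(a₁ … aₙ) is the upper row of Mn(a₁ … aₙ₋₁).
-- For x y = 1 the upper rows of Mn(x , y , x , …) of lengths 1 … 6 are
-- (x , -1), (0 , -y), (-x , 0), (-1 , y), (0 , 1), (1 , 0): hence (u , v)³ is a
-- solution and (u , v), (u , v)² are not.  If (u , v)³ ∼ a ⊕ b with b a solution,
-- the interior (b₂ , … , bₗ₋₁) of b is a block of 1, 2 or 3 consecutive entries of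
-- the alternating cycle; but the upper-left entry of Mn of the interior of a
-- solution is ±1, whereas for such a block it is y, 0 or -y.
module Submission where

open import Defs
open import Algebra.Bundles using (CommutativeRing)
open import Data.Nat using (ℕ; zero; suc; _≤_; _<_; s≤s; z≤n)
import Data.Nat as ℕ
open import Data.List using (List; []; _∷_; _++_; _∷ʳ_; length; drop)
open import Data.List.Relation.Binary.Pointwise using (Pointwise; []; _∷_)
open import Data.Vec using (Vec; []; _∷_; toList; head; tail; init; last; initLast)
open import Data.Vec.Properties using (toList-∷ʳ)
open import Data.Product using (Σ; _×_; _,_; proj₁; proj₂)
open import Data.Sum using (_⊎_; inj₁; inj₂; [_,_]; swap)
import Data.Sum as Sum
open import Function using (_∘_)
open import Relation.Binary.PropositionalEquality as ≡ using (_≡_)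
open import Relation.Nullary using (¬_)
import Algebra.Properties.Ring as RingProperties

toList-∷-init-last : ∀ {a} {A : Set a} {n} (xs : Vec A (suc (suc n))) →
                     toList xs ≡ head xs ∷ (toList (init (tail xs)) ∷ʳ last (tail xs))
toList-∷-init-last (x ∷ xs) =
  ≡.cong (x ∷_) (≡.trans (≡.cong toList (proj₂ (proj₂ (initLast xs))))
                         (toList-∷ʳ (last xs) (init xs)))

Pointwise-++-∷⇒drop : ∀ {a b r} {A : Set a} {B : Set b} {R : A → B → Set r} {n z ys ws}
                      (xs : Vec A n) → Pointwise R (toList xs ++ z ∷ ys) ws →
                      Pointwise R ys (drop (suc n) ws)
Pointwise-++-∷⇒drop []       (_ ∷ ys∼) = ys∼
Pointwise-++-∷⇒drop (_ ∷ xs) (_ ∷ rest) = Pointwise-++-∷⇒drop xs rest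

module Dynomial {c ℓ} (R : CommutativeRing c ℓ) where
  open CommutativeRing R renaming (Carrier to A)
  open RingProperties ring using (-1*x≈-x; -‿involutive; -0#≈0#; -‿distribˡ-*)
  open import Relation.Binary.Reasoning.Setoid setoid

  infix 4 _≈±1 _≈ᴿ_

  x*-1≈-x : ∀ x → x * - 1# ≈ - x
  x*-1≈-x x = trans (*-comm x (- 1#)) (-1*x≈-x x)

  0*x+z≈z : ∀ x z → 0# * x + z ≈ z
  0*x+z≈z x z = trans (+-congʳ (zeroˡ x)) (+-identityˡ z)

  inverse-comm : ∀ {x y} → x * y ≈ 1# → y * x ≈ 1#
  inverse-comm {x} {y} xy≈1 = trans (*-comm y x) xy≈1

  _≈±1 : A → Set ℓ
  x ≈±1 = x ≈ 1# ⊎ x ≈ - 1#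

  ≈±1-resp : ∀ {x y} → x ≈ y → x ≈±1 → y ≈±1
  ≈±1-resp x≈y = Sum.map (trans (sym x≈y)) (trans (sym x≈y))

  -≈±1⇒≈±1 : ∀ {x} → - x ≈±1 → x ≈±1
  -≈±1⇒≈±1 {x} (inj₁ -x≈1) = inj₂ (begin
    x     ≈⟨ -‿involutive x ⟨
    - - x ≈⟨ -‿cong -x≈1 ⟩
    - 1#  ∎)
  -≈±1⇒≈±1 {x} (inj₂ -x≈-1) = inj₁ (begin
    x        ≈⟨ -‿involutive x ⟨
    - - x    ≈⟨ -‿cong -x≈-1 ⟩
    - - 1#   ≈⟨ -‿involutive 1# ⟩
    1#       ∎)

  0≉±1 : ¬ 0# ≈ 1# → ¬ 0# ≈±1
  0≉±1 0≉1 (inj₁ 0≈1)  = 0≉1 0≈1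
  0≉±1 0≉1 (inj₂ 0≈-1) = 0≉1 (begin
    0#      ≈⟨ -0#≈0# ⟨
    - 0#    ≈⟨ -‿cong 0≈-1 ⟩
    - - 1#  ≈⟨ -‿involutive 1# ⟩
    1#      ∎)

  ≈±1-inverse : ∀ {x y} → x * y ≈ 1# → y ≈±1 → x ≈±1
  ≈±1-inverse {x} {y} xy≈1 (inj₁ y≈1) = inj₁ (begin
    x       ≈⟨ *-identityʳ x ⟨
    x * 1#  ≈⟨ *-congˡ y≈1 ⟨
    x * y   ≈⟨ xy≈1 ⟩
    1#      ∎)
  ≈±1-inverse {x} {y} xy≈1 (inj₂ y≈-1) = inj₂ (begin
    x           ≈⟨ -‿involutive x ⟨
    - - x       ≈⟨ -‿cong (x*-1≈-x x) ⟨
    - (x * - 1#) ≈⟨ -‿cong (*-congˡ y≈-1) ⟨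
    - (x * y)   ≈⟨ -‿cong xy≈1 ⟩
    - 1#        ∎)

  solution⇒m11≈±1 : ∀ cs → IsSolution R cs → Mat₂.m11 (Mn R cs) ≈±1
  solution⇒m11≈±1 _ (inj₁ (m11≈1 , _))  = inj₁ m11≈1
  solution⇒m11≈±1 _ (inj₂ (m11≈-1 , _)) = inj₂ m11≈-1

  solution⇒m22≈±1 : ∀ cs → IsSolution R cs → Mat₂.m22 (Mn R cs) ≈±1
  solution⇒m22≈±1 _ (inj₁ (_ , _ , _ , m22≈1))  = inj₁ m22≈1
  solution⇒m22≈±1 _ (inj₂ (_ , _ , _ , m22≈-1)) = inj₂ m22≈-1

  Row : Set c
  Row = A × A

  record _≈ᴿ_ (ρ σ : Row) : Set ℓ where
    constructor _,_
    field
      ≈₁ : proj₁ ρ ≈ proj₁ σ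
      ≈₂ : proj₂ ρ ≈ proj₂ σ
  open _≈ᴿ_

  ≈ᴿ-refl : ∀ {ρ} → ρ ≈ᴿ ρ
  ≈ᴿ-refl = refl , refl

  ≈ᴿ-sym : ∀ {ρ σ} → ρ ≈ᴿ σ → σ ≈ᴿ ρ
  ≈ᴿ-sym (r≈ , s≈) = sym r≈ , sym s≈

  ≈ᴿ-trans : ∀ {ρ σ τ} → ρ ≈ᴿ σ → σ ≈ᴿ τ → ρ ≈ᴿ τ
  ≈ᴿ-trans (r≈ , s≈) (r≈′ , s≈′) = trans r≈ r≈′ , trans s≈ s≈′

  upper lower : Mat₂ A → Row
  upper (mat a b _ _) = a , b
  lower (mat _ _ c′ d) = c′ , d

  step : A → Row → Row
  step a (r , s) = r * a + s , - r

  step-cong : ∀ {a a′ ρ σ} → a ≈ a′ → ρ ≈ᴿ σ → step a ρ ≈ᴿ step a′ σ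
  step-cong a≈ (r≈ , s≈) = +-cong (*-cong r≈ a≈) s≈ , -‿cong r≈

  row·Mₐ≈step : ∀ r s a → (r * a + s * 1# , r * - 1# + s * 0#) ≈ᴿ step a (r , s)
  row·Mₐ≈step r s a = +-congˡ (*-identityʳ s) , (begin
    r * - 1# + s * 0#  ≈⟨ +-cong (x*-1≈-x r) (zeroʳ s) ⟩
    - r + 0#           ≈⟨ +-identityʳ (- r) ⟩
    - r                ∎)

  upper-Mn-∷ : ∀ a as {ρ} → upper (Mn R as) ≈ᴿ ρ → upper (Mn R (a ∷ as)) ≈ᴿ step a ρ
  upper-Mn-∷ a _ as≈ρ = ≈ᴿ-trans (row·Mₐ≈step _ _ a) (step-cong refl as≈ρ)

  lower-Mn-∷ : ∀ a as {ρ} → lower (Mn R as) ≈ᴿ ρ → lower (Mn R (a ∷ as)) ≈ᴿ step a ρ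
  lower-Mn-∷ a _ as≈ρ = ≈ᴿ-trans (row·Mₐ≈step _ _ a) (step-cong refl as≈ρ)

  upper-Mn-cong : ∀ {xs ys} → Pointwise _≈_ xs ys → upper (Mn R xs) ≈ᴿ upper (Mn R ys)
  upper-Mn-cong []                = ≈ᴿ-refl
  upper-Mn-cong {x ∷ xs} {y ∷ ys} (x≈y ∷ xs≈ys) =
    ≈ᴿ-trans (upper-Mn-∷ x xs (upper-Mn-cong xs≈ys))
             (≈ᴿ-trans (step-cong x≈y ≈ᴿ-refl) (≈ᴿ-sym (upper-Mn-∷ y ys ≈ᴿ-refl)))

  lower-Mn-∷ʳ : ∀ as b → lower (Mn R (as ∷ʳ b)) ≈ᴿ upper (Mn R as)
  lower-Mn-∷ʳ []       b = ≈ᴿ-trans (lower-Mn-∷ b [] ≈ᴿ-refl) (0*x+z≈z b 1# , -0#≈0#)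
  lower-Mn-∷ʳ (a ∷ as) b =
    ≈ᴿ-trans (lower-Mn-∷ a (as ∷ʳ b) (lower-Mn-∷ʳ as b))
             (≈ᴿ-sym (upper-Mn-∷ a as ≈ᴿ-refl))

  solution⇒inner-m11≈±1 : ∀ b mid b′ → IsSolution R (b ∷ (mid ∷ʳ b′)) →
                          Mat₂.m11 (Mn R mid) ≈±1
  solution⇒inner-m11≈±1 b mid b′ sol =
    -≈±1⇒≈±1 (≈±1-resp m22≈-m11 (solution⇒m22≈±1 (b ∷ (mid ∷ʳ b′)) sol))
    where
    m22≈-m11 : Mat₂.m22 (Mn R (b ∷ (mid ∷ʳ b′))) ≈ - Mat₂.m11 (Mn R mid)
    m22≈-m11 = ≈₂ (lower-Mn-∷ b (mid ∷ʳ b′) (lower-Mn-∷ʳ mid b′))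

  alternate : A → A → ℕ → List A
  alternate x y zero    = []
  alternate x y (suc n) = x ∷ alternate y x n

  upper-alternate₁ : ∀ x y → upper (Mn R (alternate x y 1)) ≈ᴿ (x , - 1#)
  upper-alternate₁ x y =
    ≈ᴿ-trans (upper-Mn-∷ x [] ≈ᴿ-refl) (trans (+-identityʳ _) (*-identityˡ x) , refl)

  upper-alternate₂ : ∀ {x y} → x * y ≈ 1# → upper (Mn R (alternate x y 2)) ≈ᴿ (0# , - y)
  upper-alternate₂ {x} {y} xy≈1 =
    ≈ᴿ-trans (upper-Mn-∷ x (alternate y x 1) (upper-alternate₁ y x))
             (trans (+-congʳ (inverse-comm xy≈1)) (-‿inverseʳ 1#) , refl)

  upper-alternate₃ : ∀ {x y} → x * y ≈ 1# → upper (Mn R (alternate x y 3)) ≈ᴿ (- x , 0#)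
  upper-alternate₃ {x} {y} xy≈1 =
    ≈ᴿ-trans (upper-Mn-∷ x (alternate y x 2) (upper-alternate₂ (inverse-comm xy≈1)))
             (0*x+z≈z x (- x) , -0#≈0#)

  upper-alternate₄ : ∀ {x y} → x * y ≈ 1# → upper (Mn R (alternate x y 4)) ≈ᴿ (- 1# , y)
  upper-alternate₄ {x} {y} xy≈1 =
    ≈ᴿ-trans (upper-Mn-∷ x (alternate y x 3) (upper-alternate₃ (inverse-comm xy≈1)))
             (-y*x+0≈-1 , -‿involutive y)
    where
    -y*x+0≈-1 : - y * x + 0# ≈ - 1#
    -y*x+0≈-1 = begin
      - y * x + 0#  ≈⟨ +-identityʳ _ ⟩
      - y * x       ≈⟨ -‿distribˡ-* y x ⟨
      - (y * x)     ≈⟨ -‿cong (inverse-comm xy≈1) ⟩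
      - 1#          ∎

  upper-alternate₅ : ∀ {x y} → x * y ≈ 1# → upper (Mn R (alternate x y 5)) ≈ᴿ (0# , 1#)
  upper-alternate₅ {x} {y} xy≈1 =
    ≈ᴿ-trans (upper-Mn-∷ x (alternate y x 4) (upper-alternate₄ (inverse-comm xy≈1)))
             (trans (+-congʳ (-1*x≈-x x)) (-‿inverseˡ x) , -‿involutive 1#)

  upper-alternate₆ : ∀ {x y} → x * y ≈ 1# → upper (Mn R (alternate x y 6)) ≈ᴿ (1# , 0#)
  upper-alternate₆ {x} {y} xy≈1 =
    ≈ᴿ-trans (upper-Mn-∷ x (alternate y x 5) (upper-alternate₅ (inverse-comm xy≈1)))
             (0*x+z≈z x 1# , -0#≈0#)

  alternate₆-solution : ∀ {x y} → x * y ≈ 1# → _≈M_ R (Mn R (alternate x y 6)) (Id₂ R)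
  alternate₆-solution {x} {y} xy≈1 = ≈₁ upper₆ , ≈₂ upper₆ , ≈₁ lower₆ , ≈₂ lower₆
    where
    upper₆ : upper (Mn R (alternate x y 6)) ≈ᴿ (1# , 0#)
    upper₆ = upper-alternate₆ xy≈1
    lower₆ : lower (Mn R (alternate x y 6)) ≈ᴿ (0# , 1#)
    lower₆ = ≈ᴿ-trans (lower-Mn-∷ʳ (alternate x y 5) y) (upper-alternate₅ xy≈1)

  alternate₂-not-solution : ∀ {x y} → ¬ 0# ≈ 1# → x * y ≈ 1# →
                            ¬ IsSolution R (alternate x y 2)
  alternate₂-not-solution {x} {y} 0≉1 xy≈1 sol =
    0≉±1 0≉1 (≈±1-resp (≈₁ (upper-alternate₂ xy≈1))
                       (solution⇒m11≈±1 (alternate x y 2) sol))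

  alternate₄-not-solution : ∀ {x y} → ¬ 0# ≈ 1# → x * y ≈ 1# →
                            ¬ IsSolution R (alternate x y 4)
  alternate₄-not-solution {x} {y} 0≉1 xy≈1 sol =
    0≉±1 0≉1 (≈±1-resp m22≈0 (solution⇒m22≈±1 (alternate x y 4) sol))
    where
    m22≈0 : Mat₂.m22 (Mn R (alternate x y 4)) ≈ 0#
    m22≈0 = ≈₂ (≈ᴿ-trans (lower-Mn-∷ʳ (alternate x y 3) y) (upper-alternate₃ xy≈1))

  rotate-alternate₆ : ∀ k x y → rotate R k (alternate x y 6) ≡ alternate x y 6
                              ⊎ rotate R k (alternate x y 6) ≡ alternate y x 6
  rotate-alternate₆ zero    x y = inj₁ ≡.refl
  rotate-alternate₆ (suc k) x y = swap (rotate-alternate₆ k y x)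

  alternate₆-∼ : ∀ {x y ds} → _∼_ R (alternate x y 6) ds →
                 Pointwise _≈_ ds (alternate x y 6) ⊎ Pointwise _≈_ ds (alternate y x 6)
  alternate₆-∼ {x} {y} (k , inj₁ ds≈) with rotate-alternate₆ k x y
  ... | inj₁ e = inj₁ (≡.subst (Pointwise _≈_ _) e ds≈)
  ... | inj₂ e = inj₂ (≡.subst (Pointwise _≈_ _) e ds≈)
  -- reverse (alternate x y 6) reduces to alternate y x 6
  alternate₆-∼ {x} {y} (k , inj₂ ds≈) with rotate-alternate₆ k y x
  ... | inj₁ e = inj₂ (≡.subst (Pointwise _≈_ _) e ds≈)
  ... | inj₂ e = inj₁ (≡.subst (Pointwise _≈_ _) e ds≈)

  ⊕-inner-suffix : ∀ {n m cs} (as : Vec A (suc (suc n))) (bs : Vec A (suc (suc m))) →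
                   Pointwise _≈_ (_⊕_ R as bs) cs →
                   Pointwise _≈_ (toList (init (tail bs))) (drop (suc (suc n)) cs)
  ⊕-inner-suffix as bs (_ ∷ as⊕bs≈) = Pointwise-++-∷⇒drop (init (tail as)) as⊕bs≈

  module _ {x y : A} (0≉1 : ¬ 0# ≈ 1#) (xy≈1 : x * y ≈ 1#) (y≉±1 : ¬ y ≈±1) where

    alternate₆-suffix-m11≉±1 : ∀ n {m} (mid : Vec A (suc m)) →
      Pointwise _≈_ (toList mid) (drop (3 ℕ.+ n) (alternate x y 6)) →
      ¬ Mat₂.m11 (Mn R (toList mid)) ≈±1
    alternate₆-suffix-m11≉±1 0 mid mid≈ m11≈±1 =
      y≉±1 (-≈±1⇒≈±1 (≈±1-resp m11≈-y m11≈±1))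
      where
      m11≈-y : Mat₂.m11 (Mn R (toList mid)) ≈ - y
      m11≈-y = ≈₁ (≈ᴿ-trans (upper-Mn-cong mid≈) (upper-alternate₃ (inverse-comm xy≈1)))
    alternate₆-suffix-m11≉±1 1 mid mid≈ m11≈±1 =
      0≉±1 0≉1 (≈±1-resp m11≈0 m11≈±1)
      where
      m11≈0 : Mat₂.m11 (Mn R (toList mid)) ≈ 0#
      m11≈0 = ≈₁ (≈ᴿ-trans (upper-Mn-cong mid≈) (upper-alternate₂ xy≈1))
    alternate₆-suffix-m11≉±1 2 mid mid≈ m11≈±1 =
      y≉±1 (≈±1-resp m11≈y m11≈±1)
      where
      m11≈y : Mat₂.m11 (Mn R (toList mid)) ≈ y
      m11≈y = ≈₁ (≈ᴿ-trans (upper-Mn-cong mid≈) (upper-alternate₁ y x))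
    alternate₆-suffix-m11≉±1 3                         (_ ∷ _) ()
    alternate₆-suffix-m11≉±1 (suc (suc (suc (suc _)))) (_ ∷ _) ()

    alternate₆≉⊕solution : ∀ {n m} (as : Vec A (3 ℕ.+ n)) (bs : Vec A (3 ℕ.+ m)) →
                           IsSolution R (toList bs) →
                           ¬ Pointwise _≈_ (_⊕_ R as bs) (alternate x y 6)
    alternate₆≉⊕solution {n} as bs sol as⊕bs≈ =
      alternate₆-suffix-m11≉±1 n (init (tail bs)) (⊕-inner-suffix as bs as⊕bs≈)
        (solution⇒inner-m11≈±1 (head bs) (toList (init (tail bs))) (last (tail bs))
          (≡.subst (IsSolution R) (toList-∷-init-last bs) sol))

  alternate₆-irreducible : ∀ {x y} → ¬ 0# ≈ 1# → x * y ≈ 1# → ¬ x ≈±1 → ¬ y ≈±1 →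
                           ¬ IsReducible R (alternate x y 6)
  alternate₆-irreducible 0≉1 xy≈1 x≉±1 y≉±1 (_ , _ , as , bs , sol , ∼as⊕bs) =
    [ alternate₆≉⊕solution 0≉1 xy≈1 y≉±1 as bs sol
    , alternate₆≉⊕solution 0≉1 (inverse-comm xy≈1) x≉±1 as bs sol
    ] (alternate₆-∼ ∼as⊕bs)

proposition5p2 : ∀ {c ℓ} (R : CommutativeRing c ℓ) →
    let open CommutativeRing R renaming (Carrier to A) in
    IsFinite R → ¬ (0# ≈ 1#) →
    (u v : A) → IsInverse R u v → ¬ (u ≈ 1#) → ¬ (u ≈ - 1#) → ¬ (u ≈ v) →
    Σ ℕ λ k → IsDynomialMinimal R u v k × (length (dyn R u v k) ≡ 6)
      × IsIrreducibleSolution R (dyn R u v k)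
proposition5p2 R _ 0≉1 u v uv≈1 u≉1 u≉-1 _ =
  3 , (s≤s z≤n , solution , smaller-not-solution) , ≡.refl
    , solution , s≤s (s≤s (s≤s z≤n)) , alternate₆-irreducible 0≉1 uv≈1 u≉±1 v≉±1
  where
  open Dynomial R

  u≉±1 : ¬ u ≈±1
  u≉±1 = [ u≉1 , u≉-1 ]

  v≉±1 : ¬ v ≈±1
  v≉±1 = u≉±1 ∘ ≈±1-inverse uv≈1

  solution : IsSolution R (dyn R u v 3)
  solution = inj₁ (alternate₆-solution uv≈1)

  smaller-not-solution : ∀ j → 1 ≤ j → j < 3 → ¬ IsSolution R (dyn R u v j)
  smaller-not-solution 1 _ _ = alternate₂-not-solution 0≉1 uv≈1
  smaller-not-solution 2 _ _ = alternate₄-not-solution 0≉1 uv≈1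
  smaller-not-solution (suc (suc (suc _))) _ (s≤s (s≤s (s≤s ())))
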